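{- For every closed disjunctive $\mathsf{A}$-clause $\varphi$ there exists an $\mathrm{ML}(\mathbin{\underline{\vee}})$-formula $\varphi^*$ such that for every Kripke model $\mathfrak{M}$: $\mathfrak{M}\Vdash\varphi$ if and only if $\mathfrak{M}\models\varphi^*$.
   Context: $\mathrm{ML}$-formulas: $\varphi ::= p \mid \neg p \mid (\varphi\wedge\varphi)\mid(\varphi\vee\varphi)\mid\Diamond\varphi\mid\Box\varphi$. A closed disjunctive $\mathsf{A}$-clause is $\mathsf{A}\psi_1\vee\dots\vee\mathsf{A}\psi_n$ with $\psi_i\in\mathrm{ML}$, with Kripke semantics ($\mathfrak{M},w\Vdash\mathsf{A}\psi$ iff $\psi$ true at every point of $\mathfrak{M}$); $\mathfrak{M}\Vdash\chi$ means $\chi$ is true at every point. $\mathrm{ML}(\mathbin{\underline{\vee}})$ adds $(\varphi\mathbin{\underline{\vee}}\varphi)$, with team semantics over $\mathfrak{M}=(W,R,V)$, $T\subseteq W$: $T\models p$ iff $T\subseteq V(p)$; $T\models\neg p$ iff $T\cap V(p)=\emptyset$; $\wedge$ conjunction; $T\models\varphi\vee\psi$ iff $T=T_1\cup T_2$ with $T_1\models\varphi$, $T_2\models\psi$; $T\models\Diamond\varphi$ iff $T'\models\varphi$ for some $T'$ with each point of $T$ having an $R$-successor in $T'$ and each point of $T'$ an $R$-predecessor in $T$; $T\models\Box\varphi$ iff $R[T]\models\varphi$; $T\models\varphi\mathbin{\underline{\vee}}\psi$ iff $T\models\varphi$ or $T\models\psi$. $\mathfrak{M}\models\varphi$ means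 every team of $\mathfrak{M}$ satisfies $\varphi$. -}

module Defs where

open import Data.Nat using (ℕ)
open import Data.Product using (Σ; _×_; ∃)
open import Data.Sum using (_⊎_)
open import Data.Empty using (⊥)
open import Data.List.NonEmpty using (List⁺; toList)
open import Data.List.Relation.Unary.Any using (Any)
open import Function.Bundles using (_⇔_)
open import Level using (suc; zero)

Prop : Set
Prop = ℕ

-- ML-formulas in negation normal form.
data ML : Set where
  var  : Prop → ML
  nvar : Prop → ML
  _∧_  : ML → ML → ML
  _∨_  : ML → ML → ML
  ◇_   : ML → ML
  □_   : ML → ML

data MLv : Set where
  var  : Prop → MLv
  nvar : Prop → MLv
  _∧_  : MLv → MLv → MLv
  _∨_  : MLv → MLv → MLv
  ◇_   : MLv → MLv
  □_   : MLv → MLv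
  _⩒_  : MLv → MLv → MLv

-- Kripke models (nonempty domain, witnessed by a point).
record Model : Set₁ where
  field
    W  : Set
    w₀ : W
    R  : W → W → Set
    V  : Prop → W → Set
open Model public

_,_⊩_ : (M : Model) → W M → ML → Set
M , w ⊩ var p  = V M p w
M , w ⊩ nvar p = V M p w → ⊥
M , w ⊩ (φ ∧ ψ) = (M , w ⊩ φ) × (M , w ⊩ ψ)
M , w ⊩ (φ ∨ ψ) = (M , w ⊩ φ) ⊎ (M , w ⊩ ψ)
M , w ⊩ (◇ φ) = Σ (W M) λ v → R M w v × (M , v ⊩ φ)
M , w ⊩ (□ φ) = (v : W M) → R M w v → M , v ⊩ φ

_⊩A_ : Model → ML → Set
M ⊩A ψ = (w : W M) → M , w ⊩ ψ

-- Closed disjunctive A-clause  Aψ₁ ∨ … ∨ Aψₙ  (n ≥ 1), given by its list of ψᵢ.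
AClause : Set
AClause = List⁺ ML

-- M ⊩ (Aψ₁ ∨ … ∨ Aψₙ) at a point w; the truth value does not depend on w.
_,_⊩clause_ : (M : Model) → W M → AClause → Set
M , w ⊩clause c = Any (λ ψ → M ⊩A ψ) (toList c)

_⊩clause_ : Model → AClause → Set
M ⊩clause c = (w : W M) → M , w ⊩clause c

Team : Model → Set₁
Team M = W M → Set

_,_⊨_ : (M : Model) → Team M → MLv → Set₁
M , T ⊨ var p  = Level.Lift _ ((w : W M) → T w → V M p w)
M , T ⊨ nvar p = Level.Lift _ ((w : W M) → T w → V M p w → ⊥)
M , T ⊨ (φ ∧ ψ) = (M , T ⊨ φ) × (M , T ⊨ ψ)
M , T ⊨ (φ ∨ ψ) = Σ (Team M) λ T₁ → Σ (Team M) λ T₂ →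
  ((w : W M) → T w → T₁ w ⊎ T₂ w) ×
  ((w : W M) → T₁ w ⊎ T₂ w → T w) ×
  (M , T₁ ⊨ φ) × (M , T₂ ⊨ ψ)
M , T ⊨ (◇ φ) = Σ (Team M) λ T′ →
  ((w : W M) → T w → Σ (W M) λ v → R M w v × T′ v) ×
  ((v : W M) → T′ v → Σ (W M) λ w → R M w v × T w) ×
  (M , T′ ⊨ φ)
M , T ⊨ (□ φ) = M , (λ v → Σ (W M) λ w → T w × R M w v) ⊨ φ
M , T ⊨ (φ ⩒ ψ) = (M , T ⊨ φ) ⊎ (M , T ⊨ ψ)

_⊨_ : Model → MLv → Set₁
M ⊨ φ = (T : Team M) → M , T ⊨ φ

-- ML-formulas are flat: a team satisfies (the embedding of) ψ exactly when every
-- point of it forces ψ.  Hence the full team satisfies ψ iff Aψ holds, and every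
-- team satisfies ψ iff the full team does.  The A-clause Aψ₁ ∨ … ∨ Aψₙ therefore
-- becomes the Boolean disjunction ψ₁ ⩒ … ⩒ ψₙ: validity of a ⩒-disjunction of flat
-- formulas is decided on the full team, where ⩒ is read disjunct by disjunct.
module Submission where

open import Defs
open import Data.Product using (Σ; proj₁; proj₂; _×_) renaming (_,_ to _,,_)
open import Data.Sum using (_⊎_; inj₁; inj₂)
open import Data.List using (List; []; _∷_)
open import Data.List.NonEmpty as List⁺ using (List⁺; _∷_; toList)
open import Data.List.Relation.Unary.Any as Any using (Any; here; there)
open import Data.List.Relation.Unary.Any.Properties using (map⁺; map⁻)
open import Data.Unit using (⊤; tt)
open import Function.Bundles using (_⇔_; mk⇔; Equivalence)
open import Level using (lift; lower)

embed : ML → MLv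
embed (var p)  = var p
embed (nvar p) = nvar p
embed (φ ∧ ψ)  = embed φ ∧ embed ψ
embed (φ ∨ ψ)  = embed φ ∨ embed ψ
embed (◇ φ)    = ◇ embed φ
embed (□ φ)    = □ embed φ

_,_⊩ᵀ_ : (M : Model) → Team M → ML → Set
M , T ⊩ᵀ ψ = (w : W M) → T w → M , w ⊩ ψ

fullTeam : (M : Model) → Team M
fullTeam M _ = ⊤

⊩ᵀ⇒⊨-embed : (M : Model) (ψ : ML) (T : Team M) → M , T ⊩ᵀ ψ → M , T ⊨ embed ψ
⊩ᵀ⇒⊨-embed M (var p)  T h = lift h
⊩ᵀ⇒⊨-embed M (nvar p) T h = lift h
⊩ᵀ⇒⊨-embed M (φ ∧ ψ)  T h =
  ⊩ᵀ⇒⊨-embed M φ T (λ w t → proj₁ (h w t)) ,, ⊩ᵀ⇒⊨-embed M ψ T (λ w t → proj₂ (h w t))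
⊩ᵀ⇒⊨-embed M (φ ∨ ψ)  T h =
  Tφ ,, Tψ ,, split ,, (λ { w (inj₁ (t ,, _)) → t ; w (inj₂ (t ,, _)) → t }) ,,
  ⊩ᵀ⇒⊨-embed M φ Tφ (λ _ → proj₂) ,, ⊩ᵀ⇒⊨-embed M ψ Tψ (λ _ → proj₂)
  where
  Tφ Tψ : Team M
  Tφ w = T w × M , w ⊩ φ
  Tψ w = T w × M , w ⊩ ψ

  split : (w : W M) → T w → Tφ w ⊎ Tψ w
  split w t with h w t
  ... | inj₁ x = inj₁ (t ,, x)
  ... | inj₂ y = inj₂ (t ,, y)
⊩ᵀ⇒⊨-embed M (◇ φ)    T h =
  T′ ,,
  (λ w t → let (v ,, r ,, x) = h w t in v ,, r ,, (w ,, t ,, r ,, x)) ,,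
  (λ { v (w ,, t ,, r ,, _) → w ,, r ,, t }) ,,
  ⊩ᵀ⇒⊨-embed M φ T′ (λ { v (_ ,, _ ,, _ ,, x) → x })
  where
  T′ : Team M
  T′ v = Σ (W M) λ w → T w × R M w v × M , v ⊩ φ
⊩ᵀ⇒⊨-embed M (□ φ)    T h = ⊩ᵀ⇒⊨-embed M φ _ (λ { v (w ,, t ,, r) → h w t v r })

⊨-embed⇒⊩ᵀ : (M : Model) (ψ : ML) (T : Team M) → M , T ⊨ embed ψ → M , T ⊩ᵀ ψ
⊨-embed⇒⊩ᵀ M (var p)  T h w t = lower h w t
⊨-embed⇒⊩ᵀ M (nvar p) T h w t = lower h w t
⊨-embed⇒⊩ᵀ M (φ ∧ ψ)  T (hφ ,, hψ) w t = ⊨-embed⇒⊩ᵀ M φ T hφ w t ,, ⊨-embed⇒⊩ᵀ M ψ T hψ w t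
⊨-embed⇒⊩ᵀ M (φ ∨ ψ)  T (T₁ ,, T₂ ,, cover ,, _ ,, hφ ,, hψ) w t with cover w t
... | inj₁ t₁ = inj₁ (⊨-embed⇒⊩ᵀ M φ T₁ hφ w t₁)
... | inj₂ t₂ = inj₂ (⊨-embed⇒⊩ᵀ M ψ T₂ hψ w t₂)
⊨-embed⇒⊩ᵀ M (◇ φ)    T (T′ ,, forth ,, _ ,, hφ) w t =
  let (v ,, r ,, t′) = forth w t in v ,, r ,, ⊨-embed⇒⊩ᵀ M φ T′ hφ v t′
⊨-embed⇒⊩ᵀ M (□ φ)    T h w t v r = ⊨-embed⇒⊩ᵀ M φ _ h v (w ,, t ,, r)

flatness : (M : Model) (ψ : ML) (T : Team M) → (M , T ⊨ embed ψ) ⇔ (M , T ⊩ᵀ ψ)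
flatness M ψ T = mk⇔ (⊨-embed⇒⊩ᵀ M ψ T) (⊩ᵀ⇒⊨-embed M ψ T)

⩒-fold : MLv → List MLv → MLv
⩒-fold φ []       = φ
⩒-fold φ (ψ ∷ φs) = φ ⩒ ⩒-fold ψ φs

⋁⩒ : List⁺ MLv → MLv
⋁⩒ (φ ∷ φs) = ⩒-fold φ φs

⊨-⋁⩒ : (M : Model) (T : Team M) (φs : List⁺ MLv) → (M , T ⊨ ⋁⩒ φs) ⇔ Any (M , T ⊨_) (toList φs)
⊨-⋁⩒ M T (φ ∷ φs) = mk⇔ (to φ φs) (from φ φs)
  where
  to : (φ : MLv) (φs : List MLv) → M , T ⊨ ⩒-fold φ φs → Any (M , T ⊨_) (φ ∷ φs)
  to φ []       h        = here h
  to φ (ψ ∷ φs) (inj₁ h) = here h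
  to φ (ψ ∷ φs) (inj₂ h) = there (to ψ φs h)

  from : (φ : MLv) (φs : List MLv) → Any (M , T ⊨_) (φ ∷ φs) → M , T ⊨ ⩒-fold φ φs
  from φ []       (here h)  = h
  from φ (ψ ∷ φs) (here h)  = inj₁ h
  from φ (ψ ∷ φs) (there h) = inj₂ (from ψ φs h)

lemmaC3 : (φ : AClause) → Σ MLv λ φ* → (M : Model) → (M ⊩clause φ) ⇔ (M ⊨ φ*)
lemmaC3 φ = φ* ,, λ M → mk⇔ (valid M) (clause M)
  where
  φ* : MLv
  φ* = ⋁⩒ (List⁺.map embed φ)

  valid : (M : Model) → M ⊩clause φ → M ⊨ φ*
  valid M h T = Equivalence.from (⊨-⋁⩒ M T (List⁺.map embed φ))
    (map⁺ (Any.map (λ {ψ} hψ → Equivalence.from (flatness M ψ T) (λ w _ → hψ w)) (h (w₀ M))))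

  clause : (M : Model) → M ⊨ φ* → M ⊩clause φ
  clause M h _ = Any.map (λ {ψ} hψ w → Equivalence.to (flatness M ψ (fullTeam M)) hψ w tt)
    (map⁻ (Equivalence.to (⊨-⋁⩒ M (fullTeam M) (List⁺.map embed φ)) (h (fullTeam M))))
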